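{- The complete symmetric digraph $K_{18}^\ast$ admits a resolvable decomposition into directed $9$-cycles.
   Context: $K_n^\ast$ denotes the complete symmetric digraph of order $n$: it has $n$ vertices and, for each pair of distinct vertices $u,v$, both arcs $(u,v)$ and $(v,u)$. A decomposition of a digraph $D$ is a collection of subdigraphs whose arc sets partition the arc set of $D$. A resolution class is a subcollection whose members' vertex sets partition the vertex set of $D$; a decomposition is resolvable if it can be partitioned into resolution classes. -}

module Defs where

open import Data.Nat using (ℕ; suc; _%_)
open import Data.Nat.DivMod using (m%n<n)
open import Data.Fin using (Fin; toℕ; fromℕ<)
open import Data.Product using (Σ; ∃; ∃-syntax; _×_; ∃!)
open import Relation.Binary.PropositionalEquality using (_≡_; _≢_)
open import Function.Definitions using (Injective)

next : {k : ℕ} → Fin (suc k) → Fin (suc k)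
next {k} i = fromℕ< (m%n<n (suc (toℕ i)) (suc k))

-- A directed (suc k)-cycle in K*_n : a cyclic sequence of suc k pairwise
-- distinct vertices v₀ → v₁ → … → v_k → v₀.
record DCycle (n k : ℕ) : Set where
  constructor dcycle
  field
    vert : Fin (suc k) → Fin n
    inj  : Injective _≡_ _≡_ vert
open DCycle public

ArcIn : {n k : ℕ} → Fin n → Fin n → DCycle n k → Set
ArcIn u v c = ∃[ p ] (vert c p ≡ u × vert c (next p) ≡ v)

VertIn : {n k : ℕ} → Fin n → DCycle n k → Set
VertIn x c = ∃[ p ] (vert c p ≡ x)

-- A resolvable decomposition of K*_n into directed ℓ-cycles (ℓ = suc k):
-- a finite family of N cycles, each assigned to one of m resolution classes, s.t.
--  * decomposition: every arc (u,v), u ≢ v, of K*_n lies in exactly one cycle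
--    (arcs of the cycles are automatically arcs of K*_n, by injectivity);
--  * resolution: within every class, every vertex lies in exactly one cycle.
record ResolvableDecomp (n k : ℕ) : Set where
  field
    N     : ℕ
    m     : ℕ
    cyc   : Fin N → DCycle n k
    class : Fin N → Fin m
    arcPartition : (u v : Fin n) → u ≢ v → ∃! _≡_ (λ t → ArcIn u v (cyc t))
    resolution   : (c : Fin m) (x : Fin n) →
                   ∃! _≡_ (λ t → class t ≡ c × VertIn x (cyc t))

{-# OPTIONS --safe #-}
module Submission where

-- K*₁₈ has 18 · 17 = 306 arcs, so a resolvable decomposition into directed 9-cycles
-- consists of 17 classes, each a pair of vertex-disjoint 9-cycles. We exhibit such a
-- family and certify it by counting: every arc of K*₁₈, and within each class every
-- vertex, is covered by exactly one cycle, which is decided by evaluation.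

open import Defs
open import Data.Empty using (⊥-elim)
open import Data.Nat using (ℕ; zero; suc)
import Data.Nat.Properties as ℕ
open import Data.Fin using (Fin; zero; suc; remQuot; quotient; #_)
open import Data.Fin.Properties using (_≟_; any?; all?)
open import Data.Product using (∃!; _,_)
open import Data.Vec using (Vec; _∷_; []; lookup)
open import Function.Base using (_∘_)
open import Function.Definitions using (Injective)
open import Relation.Binary.PropositionalEquality using (_≡_; _≢_; refl; cong)
open import Relation.Nullary using (¬_; yes; no)
open import Relation.Nullary.Decidable using (Dec; True; toWitness; map′; ¬?; _×-dec_; _→-dec_)
open import Relation.Unary using (Pred; Decidable)

count : ∀ {N p} {P : Pred (Fin N) p} → Decidable P → ℕ
count {zero}  P? = zero
count {suc N} P? with P? zero
... | yes _ = suc (count (P? ∘ suc))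
... | no  _ = count (P? ∘ suc)

count≡0⇒∄ : ∀ {N p} {P : Pred (Fin N) p} (P? : Decidable P) → count P? ≡ 0 → ∀ i → ¬ P i
count≡0⇒∄ {suc N} P? c i       with P? zero
count≡0⇒∄ {suc N} P? c zero    | no ¬P0 = ¬P0
count≡0⇒∄ {suc N} P? c (suc i) | no _   = count≡0⇒∄ (P? ∘ suc) c i

count≡1⇒∃! : ∀ {N p} {P : Pred (Fin N) p} (P? : Decidable P) → count P? ≡ 1 → ∃! _≡_ P
count≡1⇒∃! {suc N} {P = P} P? c with P? zero
... | yes P0 = zero , P0 , only-zero
  where
  only-zero : ∀ {j} → P j → zero ≡ j
  only-zero {zero}  _  = refl
  only-zero {suc j} Pj = ⊥-elim (count≡0⇒∄ (P? ∘ suc) (ℕ.suc-injective c) j Pj)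
... | no ¬P0 with count≡1⇒∃! (P? ∘ suc) c
...   | i , Pi , unique = suc i , Pi , only-suc-i
  where
  only-suc-i : ∀ {j} → P j → suc i ≡ j
  only-suc-i {zero}  P0 = ⊥-elim (¬P0 P0)
  only-suc-i {suc j} Pj = cong suc (unique Pj)

injective? : ∀ {m n} (f : Fin m → Fin n) → Dec (Injective _≡_ _≡_ f)
injective? f = map′ (λ inj {x} {y} → inj x y) (λ inj x y → inj)
                    (all? λ x → all? λ y → f x ≟ f y →-dec x ≟ y)

module _ {n k : ℕ} where

  arcIn? : (u v : Fin n) (c : DCycle n k) → Dec (ArcIn u v c)
  arcIn? u v c = any? λ p → vert c p ≟ u ×-dec vert c (next p) ≟ v

  vertIn? : (x : Fin n) (c : DCycle n k) → Dec (VertIn x c)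
  vertIn? x c = any? λ p → vert c p ≟ x

  module _ {N m : ℕ} (cyc : Fin N → DCycle n k) (class : Fin N → Fin m) where

    arcCounts? : Dec ((u v : Fin n) → u ≢ v → count (λ t → arcIn? u v (cyc t)) ≡ 1)
    arcCounts? = all? λ u → all? λ v → ¬? (u ≟ v) →-dec count (λ t → arcIn? u v (cyc t)) ℕ.≟ 1

    vertexCounts? : Dec ((c : Fin m) (x : Fin n) → count (λ t → class t ≟ c ×-dec vertIn? x (cyc t)) ≡ 1)
    vertexCounts? = all? λ c → all? λ x → count (λ t → class t ≟ c ×-dec vertIn? x (cyc t)) ℕ.≟ 1

    resolvableDecomp : True arcCounts? → True vertexCounts? → ResolvableDecomp n k
    resolvableDecomp arcs verts = record
      { N = N ; m = m ; cyc = cyc ; class = class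
      ; arcPartition = λ u v u≢v → count≡1⇒∃! _ (toWitness arcs u v u≢v)
      ; resolution   = λ c x → count≡1⇒∃! _ (toWitness verts c x)
      }

Cycle : Set
Cycle = Vec (Fin 18) 9

-- Vertex x + 9 i stands for (x , i) ∈ ℤ₉ × ℤ₂. Classes 2–4 and 5–7 are the orbits of
-- two base classes under (x , i) ↦ (x + 1 , i), of length 3 since both base classes are
-- invariant under x ↦ x + 3; classes 8–16 form a single orbit of length 9.
classes : Vec (Vec Cycle 2) 17
classes =
    ((# 0 ∷ # 8 ∷ # 7 ∷ # 6 ∷ # 5 ∷ # 4 ∷ # 3 ∷ # 2 ∷ # 1 ∷ []) ∷ (# 9 ∷ # 13 ∷ # 17 ∷ # 12 ∷ # 16 ∷ # 11 ∷ # 15 ∷ # 10 ∷ # 14 ∷ []) ∷ [])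
  ∷ ((# 0 ∷ # 5 ∷ # 1 ∷ # 6 ∷ # 2 ∷ # 7 ∷ # 3 ∷ # 8 ∷ # 4 ∷ []) ∷ (# 9 ∷ # 10 ∷ # 11 ∷ # 12 ∷ # 13 ∷ # 14 ∷ # 15 ∷ # 16 ∷ # 17 ∷ []) ∷ [])
  ∷ ((# 0 ∷ # 13 ∷ # 1 ∷ # 3 ∷ # 16 ∷ # 4 ∷ # 6 ∷ # 10 ∷ # 7 ∷ []) ∷ (# 2 ∷ # 9 ∷ # 14 ∷ # 8 ∷ # 15 ∷ # 11 ∷ # 5 ∷ # 12 ∷ # 17 ∷ []) ∷ [])
  ∷ ((# 1 ∷ # 14 ∷ # 2 ∷ # 4 ∷ # 17 ∷ # 5 ∷ # 7 ∷ # 11 ∷ # 8 ∷ []) ∷ (# 3 ∷ # 10 ∷ # 15 ∷ # 0 ∷ # 16 ∷ # 12 ∷ # 6 ∷ # 13 ∷ # 9 ∷ []) ∷ [])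
  ∷ ((# 2 ∷ # 15 ∷ # 3 ∷ # 5 ∷ # 9 ∷ # 6 ∷ # 8 ∷ # 12 ∷ # 0 ∷ []) ∷ (# 4 ∷ # 11 ∷ # 16 ∷ # 1 ∷ # 17 ∷ # 13 ∷ # 7 ∷ # 14 ∷ # 10 ∷ []) ∷ [])
  ∷ ((# 0 ∷ # 1 ∷ # 11 ∷ # 3 ∷ # 4 ∷ # 14 ∷ # 6 ∷ # 7 ∷ # 17 ∷ []) ∷ (# 2 ∷ # 13 ∷ # 15 ∷ # 8 ∷ # 10 ∷ # 12 ∷ # 5 ∷ # 16 ∷ # 9 ∷ []) ∷ [])
  ∷ ((# 1 ∷ # 2 ∷ # 12 ∷ # 4 ∷ # 5 ∷ # 15 ∷ # 7 ∷ # 8 ∷ # 9 ∷ []) ∷ (# 3 ∷ # 14 ∷ # 16 ∷ # 0 ∷ # 11 ∷ # 13 ∷ # 6 ∷ # 17 ∷ # 10 ∷ []) ∷ [])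
  ∷ ((# 2 ∷ # 3 ∷ # 13 ∷ # 5 ∷ # 6 ∷ # 16 ∷ # 8 ∷ # 0 ∷ # 10 ∷ []) ∷ (# 4 ∷ # 15 ∷ # 17 ∷ # 1 ∷ # 12 ∷ # 14 ∷ # 7 ∷ # 9 ∷ # 11 ∷ []) ∷ [])
  ∷ ((# 0 ∷ # 17 ∷ # 11 ∷ # 9 ∷ # 7 ∷ # 1 ∷ # 13 ∷ # 10 ∷ # 5 ∷ []) ∷ (# 2 ∷ # 16 ∷ # 15 ∷ # 6 ∷ # 3 ∷ # 12 ∷ # 8 ∷ # 14 ∷ # 4 ∷ []) ∷ [])
  ∷ ((# 1 ∷ # 9 ∷ # 12 ∷ # 10 ∷ # 8 ∷ # 2 ∷ # 14 ∷ # 11 ∷ # 6 ∷ []) ∷ (# 3 ∷ # 17 ∷ # 16 ∷ # 7 ∷ # 4 ∷ # 13 ∷ # 0 ∷ # 15 ∷ # 5 ∷ []) ∷ [])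
  ∷ ((# 2 ∷ # 10 ∷ # 13 ∷ # 11 ∷ # 0 ∷ # 3 ∷ # 15 ∷ # 12 ∷ # 7 ∷ []) ∷ (# 4 ∷ # 9 ∷ # 17 ∷ # 8 ∷ # 5 ∷ # 14 ∷ # 1 ∷ # 16 ∷ # 6 ∷ []) ∷ [])
  ∷ ((# 3 ∷ # 11 ∷ # 14 ∷ # 12 ∷ # 1 ∷ # 4 ∷ # 16 ∷ # 13 ∷ # 8 ∷ []) ∷ (# 5 ∷ # 10 ∷ # 9 ∷ # 0 ∷ # 6 ∷ # 15 ∷ # 2 ∷ # 17 ∷ # 7 ∷ []) ∷ [])
  ∷ ((# 4 ∷ # 12 ∷ # 15 ∷ # 13 ∷ # 2 ∷ # 5 ∷ # 17 ∷ # 14 ∷ # 0 ∷ []) ∷ (# 6 ∷ # 11 ∷ # 10 ∷ # 1 ∷ # 7 ∷ # 16 ∷ # 3 ∷ # 9 ∷ # 8 ∷ []) ∷ [])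
  ∷ ((# 5 ∷ # 13 ∷ # 16 ∷ # 14 ∷ # 3 ∷ # 6 ∷ # 9 ∷ # 15 ∷ # 1 ∷ []) ∷ (# 7 ∷ # 12 ∷ # 11 ∷ # 2 ∷ # 8 ∷ # 17 ∷ # 4 ∷ # 10 ∷ # 0 ∷ []) ∷ [])
  ∷ ((# 6 ∷ # 14 ∷ # 17 ∷ # 15 ∷ # 4 ∷ # 7 ∷ # 10 ∷ # 16 ∷ # 2 ∷ []) ∷ (# 8 ∷ # 13 ∷ # 12 ∷ # 3 ∷ # 0 ∷ # 9 ∷ # 5 ∷ # 11 ∷ # 1 ∷ []) ∷ [])
  ∷ ((# 7 ∷ # 15 ∷ # 9 ∷ # 16 ∷ # 5 ∷ # 8 ∷ # 11 ∷ # 17 ∷ # 3 ∷ []) ∷ (# 0 ∷ # 14 ∷ # 13 ∷ # 4 ∷ # 1 ∷ # 10 ∷ # 6 ∷ # 12 ∷ # 2 ∷ []) ∷ [])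
  ∷ ((# 8 ∷ # 16 ∷ # 10 ∷ # 17 ∷ # 6 ∷ # 0 ∷ # 12 ∷ # 9 ∷ # 4 ∷ []) ∷ (# 1 ∷ # 15 ∷ # 14 ∷ # 5 ∷ # 2 ∷ # 11 ∷ # 7 ∷ # 13 ∷ # 3 ∷ []) ∷ [])
  ∷ []

vertices : Fin 34 → Fin 9 → Fin 18
vertices t = let c , h = remQuot {17} 2 t in lookup (lookup (lookup classes c) h)

vertices-injective : ∀ t → Injective _≡_ _≡_ (vertices t)
vertices-injective = toWitness {a? = all? λ t → injective? (vertices t)} _

lemma3p5 : ResolvableDecomp 18 8
lemma3p5 = resolvableDecomp (λ t → dcycle (vertices t) (vertices-injective t)) (quotient {17} 2) _ _
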